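{- Let $\mathcal{U}$ be an ultrafilter on $\mathbb{N}$ such that for every $b\in\mathbb{N}$ the set $\{n\in\mathbb{N}: n \text{ has at least } b \text{ distinct prime divisors}\}$ belongs to $\mathcal{U}$. Then the ultraproduct ring $\prod_{n\in\mathbb{N}}\mathbb{Z}/n\mathbb{Z}\,/\,\mathcal{U}$ has TP2 theory (i.e. is not NTP2).
   Context: Rings are considered as structures in the language of rings. A formula $\varphi(x,y)$ has the tree property of the second kind (TP2) in a theory $T$ if there are parameters $\{b_{i,j}:i,j<\omega\}$ in a model of $T$ and $l<\omega$ such that (i) for every $i$, $\{\varphi(x,b_{i,j}):j<\omega\}$ is $l$-inconsistent, and (ii) for every $\xi\in\omega^\omega$, $\{\varphi(x,b_{i,\xi(i)}):i<\omega\}$ is consistent. A theory has TP2 if some formula has TP2. -}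

module Defs where

open import Level using (0ℓ)
open import Data.Nat using (ℕ; zero; suc; _+_; _<_)
open import Data.Nat.Divisibility using () renaming (_∣_ to _∣ℕ_)
open import Data.Nat.Primality using (Prime)
open import Data.Integer using (ℤ; +_) renaming (_+_ to _+ℤ_; _*_ to _*ℤ_; -_ to -ℤ_; _-_ to _-ℤ_)
import Data.Integer as ℤ
open import Data.Integer.Divisibility using () renaming (_∣_ to _∣ℤ_)
open import Data.Fin using (Fin)
open import Data.Vec.Functional using (Vector; _∷_; []; _++_)
open import Data.Product using (Σ; _×_; _,_)
open import Data.Sum using (_⊎_)
open import Data.Empty using (⊥)
open import Data.Unit using (⊤)
open import Relation.Nullary using (¬_)
open import Relation.Unary using (Pred; _⊆_; _∩_; ∁; Universal; Empty)
open import Relation.Binary using (Rel; IsEquivalence)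
open import Relation.Binary.PropositionalEquality using (_≡_)
open import Function.Definitions using (Injective)

record Ultrafilter : Set₁ where
  field
    Large       : Pred ℕ 0ℓ → Set
    full        : Large (λ (_ : ℕ) → ⊤)
    proper      : ¬ Large (λ (_ : ℕ) → ⊥)
    upward      : ∀ {A B : Pred ℕ 0ℓ} → A ⊆ B → Large A → Large B
    intersect   : ∀ {A B : Pred ℕ 0ℓ} → Large A → Large B → Large (A ∩ B)
    ultra       : ∀ (A : Pred ℕ 0ℓ) → Large A ⊎ Large (∁ A)

AtLeastDistinctPrimeDivisors : ℕ → ℕ → Set
AtLeastDistinctPrimeDivisors b n =
  Σ (Fin b → ℕ) λ p → Injective _≡_ _≡_ p × (∀ i → Prime (p i) × (p i ∣ℕ n))

data Term (n : ℕ) : Set where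
  var  : Fin n → Term n
  `0 `1 : Term n
  _`+_ _`*_ : Term n → Term n → Term n
  `-_  : Term n → Term n

data Formula (n : ℕ) : Set where
  _`≈_        : Term n → Term n → Formula n
  `⊥ `⊤       : Formula n
  `¬_         : Formula n → Formula n
  _`∧_ _`∨_ _`⇒_ : Formula n → Formula n → Formula n
  `∃ `∀       : Formula (suc n) → Formula n

Sentence : Set
Sentence = Formula 0

record RawStructure : Set₁ where
  field
    Carrier : Set
    _≈_     : Rel Carrier 0ℓ
    0#  1#  : Carrier
    _+'_ _*'_ : Carrier → Carrier → Carrier
    -'_     : Carrier → Carrier

-- A genuine L-structure: _≈_ is a congruence (i.e. a quotient presentation).
record Structure : Set₁ where
  field
    raw : RawStructure
  open RawStructure raw public
  field
    isEquivalence : IsEquivalence _≈_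
    +-cong : ∀ {a b c d} → a ≈ b → c ≈ d → (a +' c) ≈ (b +' d)
    *-cong : ∀ {a b c d} → a ≈ b → c ≈ d → (a *' c) ≈ (b *' d)
    neg-cong : ∀ {a b} → a ≈ b → (-' a) ≈ (-' b)

module _ (M : RawStructure) where
  open RawStructure M

  evalT : ∀ {n} → Term n → Vector Carrier n → Carrier
  evalT (var i) ρ = ρ i
  evalT `0 ρ = 0#
  evalT `1 ρ = 1#
  evalT (s `+ t) ρ = evalT s ρ +' evalT t ρ
  evalT (s `* t) ρ = evalT s ρ *' evalT t ρ
  evalT (`- t) ρ = -' evalT t ρ

  Sat : ∀ {n} → Formula n → Vector Carrier n → Set
  Sat (s `≈ t) ρ = evalT s ρ ≈ evalT t ρ
  Sat `⊥ ρ = ⊥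
  Sat `⊤ ρ = ⊤
  Sat (`¬ φ) ρ = ¬ Sat φ ρ
  Sat (φ `∧ ψ) ρ = Sat φ ρ × Sat ψ ρ
  Sat (φ `∨ ψ) ρ = Sat φ ρ ⊎ Sat ψ ρ
  Sat (φ `⇒ ψ) ρ = Sat φ ρ → Sat ψ ρ
  Sat (`∃ φ) ρ = Σ Carrier λ a → Sat φ (a ∷ ρ)
  Sat (`∀ φ) ρ = (a : Carrier) → Sat φ (a ∷ ρ)

Th : RawStructure → Pred Sentence 0ℓ
Th M σ = Sat M σ []

_⊨_ : Structure → Pred Sentence 0ℓ → Set
N ⊨ T = ∀ σ → T σ → Sat (Structure.raw N) σ []

-- TP2.  φ(x,y) with x a k-tuple and y an m-tuple: φ : Formula (k + m),
-- evaluated at (a , b) via the environment a ++ b.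

module _ (N : Structure) {k m : ℕ} (φ : Formula (k + m)) where
  open Structure N

  Realised : {I : Set} → (I → Vector Carrier m) → Set
  Realised c = Σ (Vector Carrier k) λ a → ∀ j → Sat raw φ (a ++ c j)

  TP2-witness : (ℕ → ℕ → Vector Carrier m) → ℕ → Set
  TP2-witness b l =
      (∀ (i : ℕ) (js : Fin l → ℕ) → Injective _≡_ _≡_ js →
         ¬ Realised (λ t → b i (js t)))
      -- (ii) each path {φ(x, b i (ξ i)) : i} is consistent
      --      (finitely satisfiable in N, i.e. consistent with the
      --       elementary diagram of N)
    × (∀ (ξ : ℕ → ℕ) (s : ℕ) →
         Realised {I = Σ ℕ (λ i → i < s)} (λ { (i , _) → b i (ξ i) }))

HasTP2 : Pred Sentence 0ℓ → Set₁
HasTP2 T =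
  Σ ℕ λ k → Σ ℕ λ m → Σ (Formula (k + m)) λ φ →
  Σ Structure λ N → (N ⊨ T) ×
  Σ (ℕ → ℕ → Vector (Structure.Carrier N) m) λ b →
  Σ ℕ λ l → TP2-witness N φ b l

-- The ultraproduct ∏ ℤ/nℤ / U, presented with carrier ℕ → ℤ
-- (component n represents a residue mod n), equality mod U.

Ultraproduct : Ultrafilter → RawStructure
Ultraproduct U = record
  { Carrier = ℕ → ℤ
  ; _≈_ = λ f g → Large (λ n → (+ n) ∣ℤ (f n -ℤ g n))
  ; 0# = λ _ → + 0
  ; 1# = λ _ → + 1
  ; _+'_ = λ f g n → f n +ℤ g n
  ; _*'_ = λ f g n → f n *ℤ g n
  ; -'_ = λ f n → -ℤ f n
  }
  where open Ultrafilter U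

-- Let q₀ > q₁ > … be the prime divisors of n and Eᵢ the product of those other than qᵢ.
-- With φ(x; y, z) : y·x = y·z and, in the n-th factor, bᵢⱼ = (n/qᵢ, j·Eᵢ), the formula
-- φ(x; bᵢⱼ) says x ≡ j·Eᵢ (mod qᵢ).  Since Eᵢ is invertible mod qᵢ and qᵢ is at least the
-- number of prime divisors of n minus i, which is U-almost always large, two distinct j give
-- contradictory conditions; and x = Σᵢ ξ(i)·Eᵢ satisfies all the conditions on a path ξ at
-- once, by the Chinese remainder theorem.

module Submission where

open import Defs

module Congruence where

  open import Data.Nat using (ℕ; zero; suc; _<_; _≟_)
  open import Data.Nat.Properties using (≤-refl; ≤-pred; <⇒≢; m<n⇒m<1+n; ≤∧≢⇒<)
  open import Data.Integer using (ℤ; +_; _+_; _*_; -_; _-_; NonZero)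
  import Data.Integer.Properties as ℤ
  open import Data.Integer.Divisibility.Signed
  import Data.Integer.Divisibility as Unsigned
  open import Relation.Binary.PropositionalEquality
  open import Relation.Nullary using (yes; no)
  open import Data.Integer.Tactic.RingSolver using (solve-∀)

  -- A record rather than d ∣ x - y itself so that x, y and d stay inferable; the ultraproduct's
  -- equality uses unsigned divisibility, hence mod⇒∣ᵤ and ∣ᵤ⇒mod.
  infix 4 _≡_mod_
  record _≡_mod_ (x y d : ℤ) : Set where
    constructor mod-intro
    field divides-difference : d ∣ x - y

  mod⇒∣ᵤ : ∀ {x y d} → x ≡ y mod d → d Unsigned.∣ x - y
  mod⇒∣ᵤ (mod-intro d∣x-y) = ∣⇒∣ᵤ d∣x-y

  ∣ᵤ⇒mod : ∀ {x y d} → d Unsigned.∣ x - y → x ≡ y mod d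
  ∣ᵤ⇒mod d∣x-y = mod-intro (∣ᵤ⇒∣ d∣x-y)

  private
    *-difference : ∀ a x y → a * x - a * y ≡ a * (x - y)
    *-difference = solve-∀

    mod-by : ∀ {d x y u} → x - y ≡ u → d ∣ u → x ≡ y mod d
    mod-by {d} x-y≡u d∣u = mod-intro (subst (d ∣_) (sym x-y≡u) d∣u)

  module _ {d : ℤ} where

    mod-refl : ∀ {x} → x ≡ x mod d
    mod-refl {x} = mod-by (ℤ.+-inverseʳ x) (divides (+ 0) refl)

    mod-sym : ∀ {x y} → x ≡ y mod d → y ≡ x mod d
    mod-sym {x} {y} (mod-intro d∣x-y) = mod-by (regroup x y) (∣m⇒∣-m d∣x-y)
      where
      regroup : ∀ x y → y - x ≡ - (x - y)
      regroup = solve-∀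

    mod-trans : ∀ {x y z} → x ≡ y mod d → y ≡ z mod d → x ≡ z mod d
    mod-trans {x} {y} {z} (mod-intro d∣x-y) (mod-intro d∣y-z) =
      mod-by (regroup x y z) (∣m∣n⇒∣m+n d∣x-y d∣y-z)
      where
      regroup : ∀ x y z → x - z ≡ (x - y) + (y - z)
      regroup = solve-∀

    +-cong-mod : ∀ {x y z w} → x ≡ y mod d → z ≡ w mod d → x + z ≡ y + w mod d
    +-cong-mod {x} {y} {z} {w} (mod-intro d∣x-y) (mod-intro d∣z-w) =
      mod-by (regroup x y z w) (∣m∣n⇒∣m+n d∣x-y d∣z-w)
      where
      regroup : ∀ x y z w → (x + z) - (y + w) ≡ (x - y) + (z - w)
      regroup = solve-∀

    *-cong-mod : ∀ {x y z w} → x ≡ y mod d → z ≡ w mod d → x * z ≡ y * w mod d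
    *-cong-mod {x} {y} {z} {w} (mod-intro d∣x-y) (mod-intro d∣z-w) =
      mod-by (regroup x y z w) (∣m∣n⇒∣m+n (∣n⇒∣m*n x d∣z-w) (∣n⇒∣m*n w d∣x-y))
      where
      regroup : ∀ x y z w → x * z - y * w ≡ x * (z - w) + w * (x - y)
      regroup = solve-∀

    ∣ᵤ⇒≡0-mod : ∀ {x} → d Unsigned.∣ x → x ≡ + 0 mod d
    ∣ᵤ⇒≡0-mod {x} d∣x = mod-by (ℤ.+-identityʳ x) (∣ᵤ⇒∣ d∣x)

    mod-respʳ : ∀ {x y z} → y ≡ z → x ≡ y mod d → x ≡ z mod d
    mod-respʳ refl x≡y = x≡y

    neg-cong-mod : ∀ {x y} → x ≡ y mod d → - x ≡ - y mod d
    neg-cong-mod {x} {y} (mod-intro d∣x-y) = mod-by (regroup x y) (∣m⇒∣-m d∣x-y)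
      where
      regroup : ∀ x y → - x - - y ≡ - (x - y)
      regroup = solve-∀

  *-monoʳ-mod : ∀ a {q d x y} → a * q ≡ d → x ≡ y mod q → a * x ≡ a * y mod d
  *-monoʳ-mod a {x = x} {y} refl (mod-intro q∣x-y) = mod-by (*-difference a x y) (*-monoʳ-∣ a q∣x-y)

  *-cancelˡ-mod : ∀ a {q d x y} .{{_ : NonZero a}} → a * q ≡ d → a * x ≡ a * y mod d → x ≡ y mod q
  *-cancelˡ-mod a {x = x} {y} refl (mod-intro aq∣ax-ay) =
    mod-intro (*-cancelˡ-∣ a (subst (_ ∣_) (*-difference a x y) aq∣ax-ay))

  sumBelow : ℕ → (ℕ → ℤ) → ℤ
  sumBelow zero    f = + 0
  sumBelow (suc s) f = sumBelow s f + f s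

  sumBelow≡0-mod : ∀ {d f} s → (∀ k → k < s → f k ≡ + 0 mod d) → sumBelow s f ≡ + 0 mod d
  sumBelow≡0-mod zero    _   = mod-refl
  sumBelow≡0-mod (suc s) f≡0 =
    mod-respʳ (ℤ.+-identityʳ (+ 0))
          (+-cong-mod (sumBelow≡0-mod s (λ k k<s → f≡0 k (m<n⇒m<1+n k<s))) (f≡0 s ≤-refl))

  sumBelow≡term-mod : ∀ {d f i} s → i < s → (∀ k → k < s → k ≢ i → f k ≡ + 0 mod d) →
                      sumBelow s f ≡ f i mod d
  sumBelow≡term-mod {f = f} {i} (suc s) i<1+s f≡0 with i ≟ s
  ... | yes refl =
    mod-respʳ (ℤ.+-identityˡ (f s))
          (+-cong-mod (sumBelow≡0-mod s (λ k k<s → f≡0 k (m<n⇒m<1+n k<s) (<⇒≢ k<s))) mod-refl)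
  ... | no i≢s =
    mod-respʳ (ℤ.+-identityʳ (f i))
          (+-cong-mod (sumBelow≡term-mod s (≤∧≢⇒< (≤-pred i<1+s) i≢s)
                                         (λ k k<s → f≡0 k (m<n⇒m<1+n k<s)))
                      (f≡0 s ≤-refl (λ s≡i → i≢s (sym s≡i))))

open Congruence

open import Data.Nat as ℕ
  using (ℕ; zero; suc; _+_; _*_; _≤_; _<_; _>_; _⊔_; z≤n; s≤s; NonZero; ∣_-_∣)
open import Data.Nat.Properties
open import Data.Nat.Divisibility using (_∣_; _∣?_; ∣⇒≤)
open import Data.Nat.DivMod using (_/_; m/n*n≡m)
open import Data.Nat.Primality using (Prime; prime?; prime[2]; prime⇒nonZero; euclidsLemma)
open import Data.Nat.Primality.Factorisation using (factorisationHasAllPrimeFactors)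
open import Data.Nat.ListAction using (product)
open import Data.Nat.ListAction.Properties using (∈⇒∣product)
open import Data.Integer as ℤ using (ℤ; +_)
import Data.Integer.Properties as ℤ
open import Data.List using (List; []; _∷_; length; filter; downFrom; lookup)
open import Data.List.Membership.Propositional using (_∈_)
open import Data.List.Membership.Propositional.Properties
  using (∈-filter⁺; ∈-filter⁻; ∈-downFrom⁺)
open import Data.List.Relation.Unary.All as All using (All; []; _∷_)
import Data.List.Relation.Unary.All.Properties as All
open import Data.List.Relation.Unary.AllPairs as AllPairs using (AllPairs; _∷_)
import Data.List.Relation.Unary.AllPairs.Properties as AllPairs
open import Data.List.Relation.Unary.Any using (here; there; index)
open import Data.List.Relation.Unary.Any.Properties using (lookup-index)
open import Data.List.Relation.Unary.Unique.Propositional using (Unique)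
open import Data.Fin using (Fin) renaming (zero to fz; suc to fs)
open import Data.Fin.Properties using (injective⇒≤)
open import Data.Vec.Functional as Vec using (Vector)
open import Data.Product using (Σ; _×_; _,_; proj₁; proj₂)
open import Data.Sum using (inj₁; inj₂)
open import Data.Empty using (⊥-elim)
open import Function using (it)
open import Function.Definitions using (Injective)
open import Relation.Nullary using (¬_; ¬?)
open import Relation.Nullary.Decidable using (_×-dec_)
open import Relation.Unary using (Pred; Decidable)
open import Level using (0ℓ)
open import Relation.Binary.PropositionalEquality
open import Data.Integer.Tactic.RingSolver using (solve-∀)

lookupOr : {A : Set} → A → List A → ℕ → A
lookupOr d []       i       = d
lookupOr d (x ∷ xs) zero    = x
lookupOr d (x ∷ xs) (suc i) = lookupOr d xs i

module _ {A : Set} {d : A} where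

  All-lookupOr : ∀ {P : A → Set} {xs} → All P xs → P d → ∀ i → P (lookupOr d xs i)
  All-lookupOr []         Pd i       = Pd
  All-lookupOr (Px ∷ _)   Pd zero    = Px
  All-lookupOr (_ ∷ Pxs)  Pd (suc i) = All-lookupOr Pxs Pd i

  ∈-lookupOr : ∀ {xs i} → i < length xs → lookupOr d xs i ∈ xs
  ∈-lookupOr {_ ∷ _}  {zero}  _         = here refl
  ∈-lookupOr {_ ∷ xs} {suc i} (s≤s i<n) = there (∈-lookupOr i<n)

  lookupOr-injective : ∀ {xs i j} → Unique xs → i < length xs → j < length xs →
                       lookupOr d xs i ≡ lookupOr d xs j → i ≡ j
  lookupOr-injective {i = zero}  {zero}  _          _         _         _  = refl
  lookupOr-injective {i = zero}  {suc j} (x∉ ∷ _)   _         (s≤s j<n) eq =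
    ⊥-elim (All.lookup x∉ (∈-lookupOr j<n) eq)
  lookupOr-injective {i = suc i} {zero}  (x∉ ∷ _)   (s≤s i<n) _         eq =
    ⊥-elim (All.lookup x∉ (∈-lookupOr i<n) (sym eq))
  lookupOr-injective {i = suc i} {suc j} (_ ∷ uniq) (s≤s i<n) (s≤s j<n) eq =
    cong suc (lookupOr-injective uniq i<n j<n eq)

Descending : List ℕ → Set
Descending = AllPairs _>_

descending⇒unique : ∀ {xs} → Descending xs → Unique xs
descending⇒unique = AllPairs.map >⇒≢

descending⇒length≤bound : ∀ {x xs} → Descending xs → All (_< x) xs → length xs ≤ x
descending⇒length≤bound {xs = []}    _            _            = z≤n
descending⇒length≤bound {xs = _ ∷ _} (y> ∷ desc) (y<x ∷ _) =
  ≤-trans (s≤s (descending⇒length≤bound desc y>)) y<x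

descending⇒length≤1+i+lookupOr : ∀ {d xs i} → Descending xs → i < length xs →
                                 length xs ≤ suc i + lookupOr d xs i
descending⇒length≤1+i+lookupOr {xs = x ∷ _} {zero}  (x> ∷ desc) _         =
  s≤s (descending⇒length≤bound desc x>)
descending⇒length≤1+i+lookupOr {xs = _ ∷ _} {suc i} (_ ∷ desc)  (s≤s i<n) =
  s≤s (descending⇒length≤1+i+lookupOr desc i<n)

PrimeDivisorOf : ℕ → ℕ → Set
PrimeDivisorOf n p = Prime p × p ∣ n

primeDivisorOf? : ∀ n → Decidable (PrimeDivisorOf n)
primeDivisorOf? n p = prime? p ×-dec p ∣? n

-- Opaque so that n stays inferable from primeDivisors n.
opaque
  primeDivisors : ℕ → List ℕ
  primeDivisors n = filter (primeDivisorOf? n) (downFrom (suc n))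

  ∈-primeDivisors⁺ : ∀ {n p} .{{_ : NonZero n}} → Prime p → p ∣ n → p ∈ primeDivisors n
  ∈-primeDivisors⁺ {n} p-prime p∣n =
    ∈-filter⁺ (primeDivisorOf? n) (∈-downFrom⁺ (s≤s (∣⇒≤ p∣n))) (p-prime , p∣n)

  ∈-primeDivisors⁻ : ∀ n {p} → p ∈ primeDivisors n → PrimeDivisorOf n p
  ∈-primeDivisors⁻ n p∈ = proj₂ (∈-filter⁻ (primeDivisorOf? n) {xs = downFrom (suc n)} p∈)

  primeDivisors-descending : ∀ n → Descending (primeDivisors n)
  primeDivisors-descending n =
    AllPairs.filter⁺ (primeDivisorOf? n)
      (AllPairs.applyDownFrom⁺₁ (λ x → x) (suc n) (λ j<i _ → j<i))

atLeast⇒≤length : ∀ {b n} .{{_ : NonZero n}} → AtLeastDistinctPrimeDivisors b n →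
                  b ≤ length (primeDivisors n)
atLeast⇒≤length {b} {n} (p , p-injective , p-primeDivisor) =
  injective⇒≤ {f = position} position-injective
  where
  p∈ : ∀ t → p t ∈ primeDivisors n
  p∈ t = ∈-primeDivisors⁺ (proj₁ (p-primeDivisor t)) (proj₂ (p-primeDivisor t))
  position : Fin b → Fin (length (primeDivisors n))
  position t = index (p∈ t)
  position-injective : ∀ {t u} → position t ≡ position u → t ≡ u
  position-injective {t} {u} eq = p-injective (begin
    p t                                   ≡⟨ lookup-index (p∈ t) ⟩
    lookup (primeDivisors n) (position t) ≡⟨ cong (lookup (primeDivisors n)) eq ⟩
    lookup (primeDivisors n) (position u) ≡⟨ lookup-index (p∈ u) ⟨
    p u                                   ∎)
    where open ≡-Reasoning

without : ℕ → List ℕ → List ℕ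
without q = filter (λ x → ¬? (x ≟ q))

∈⇒∣product-without : ∀ {q x xs} → x ∈ xs → x ≢ q → x ∣ product (without q xs)
∈⇒∣product-without x∈xs x≢q = ∈⇒∣product (∈-filter⁺ (λ x → ¬? (x ≟ _)) x∈xs x≢q)

prime∤product-without : ∀ {q xs} → Prime q → All Prime xs → ¬ q ∣ product (without q xs)
prime∤product-without {q} {xs} q-prime xs-prime q∣product =
  proj₂ (∈-filter⁻ (λ x → ¬? (x ≟ q)) {xs = xs} q∈) refl
  where
  q∈ = factorisationHasAllPrimeFactors q-prime q∣product (All.filter⁺ _ xs-prime)

∣m⊖n∣≡∣m-n∣ : ∀ m n → ℤ.∣ m ℤ.⊖ n ∣ ≡ ∣ m - n ∣
∣m⊖n∣≡∣m-n∣ zero    zero    = refl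
∣m⊖n∣≡∣m-n∣ zero    (suc n) = refl
∣m⊖n∣≡∣m-n∣ (suc m) zero    = refl
∣m⊖n∣≡∣m-n∣ (suc m) (suc n) = trans (cong ℤ.∣_∣ (ℤ.[1+m]⊖[1+n]≡m⊖n m n)) (∣m⊖n∣≡∣m-n∣ m n)

mod⇒∣∣m-n∣*o : ∀ {q m n o} → + m ℤ.* + o ≡ + n ℤ.* + o mod + q → q ∣ ∣ m - n ∣ * o
mod⇒∣∣m-n∣*o {q} {m} {n} {o} mo≡no = subst (q ∣_) ∣mo-no∣≡∣m-n∣o (mod⇒∣ᵤ mo≡no)
  where
  factor : ∀ x y z → x ℤ.* z ℤ.- y ℤ.* z ≡ (x ℤ.- y) ℤ.* z
  factor = solve-∀
  ∣mo-no∣≡∣m-n∣o : ℤ.∣ + m ℤ.* + o ℤ.- + n ℤ.* + o ∣ ≡ ∣ m - n ∣ * o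
  ∣mo-no∣≡∣m-n∣o = begin
    ℤ.∣ + m ℤ.* + o ℤ.- + n ℤ.* + o ∣ ≡⟨ cong ℤ.∣_∣ (factor (+ m) (+ n) (+ o)) ⟩
    ℤ.∣ (+ m ℤ.- + n) ℤ.* + o ∣       ≡⟨ ℤ.abs-* (+ m ℤ.- + n) (+ o) ⟩
    ℤ.∣ + m ℤ.- + n ∣ * o             ≡⟨ cong (λ z → ℤ.∣ z ∣ * o) (ℤ.[+m]-[+n]≡m⊖n m n) ⟩
    ℤ.∣ m ℤ.⊖ n ∣ * o                 ≡⟨ cong (_* o) (∣m⊖n∣≡∣m-n∣ m n) ⟩
    ∣ m - n ∣ * o                     ∎
    where open ≡-Reasoning

prime∤∣m-n∣*o : ∀ {q m n o} → Prime q → ¬ q ∣ o → m ≢ n → m ⊔ n < q → ¬ q ∣ ∣ m - n ∣ * o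
prime∤∣m-n∣*o {q} {m} {n} {o} q-prime q∤o m≢n m⊔n<q q∣∣m-n∣o
  with euclidsLemma ∣ m - n ∣ o q-prime q∣∣m-n∣o
... | inj₂ q∣o      = q∤o q∣o
... | inj₁ q∣∣m-n∣ = <⇒≱ m⊔n<q (≤-trans (∣⇒≤ {{∣m-n∣≢0}} q∣∣m-n∣) (∣m-n∣≤m⊔n m n))
  where
  ∣m-n∣≢0 : NonZero ∣ m - n ∣
  ∣m-n∣≢0 = ℕ.≢-nonZero (λ ∣m-n∣≡0 → m≢n (∣m-n∣≡0⇒m≡n ∣m-n∣≡0))

-- The (i+1)-th largest prime divisor of n; 2 is a junk value when n has at most i of them.
primeDivisor : ℕ → ℕ → ℕ
primeDivisor i n = lookupOr 2 (primeDivisors n) i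

primeDivisors-prime : ∀ n → All Prime (primeDivisors n)
primeDivisors-prime n = All.tabulate (λ p∈ → proj₁ (∈-primeDivisors⁻ n p∈))

primeDivisor-prime : ∀ i n → Prime (primeDivisor i n)
primeDivisor-prime i n = All-lookupOr (primeDivisors-prime n) prime[2] i

primeDivisor-nonZero : ∀ i n → NonZero (primeDivisor i n)
primeDivisor-nonZero i n = prime⇒nonZero (primeDivisor-prime i n)

quotient : ℕ → ℕ → ℕ
quotient i n = (n / primeDivisor i n) {{primeDivisor-nonZero i n}}

otherPrimes : ℕ → ℕ → ℕ
otherPrimes i n = product (without (primeDivisor i n) (primeDivisors n))

primeDivisor∤otherPrimes : ∀ i n → ¬ primeDivisor i n ∣ otherPrimes i n
primeDivisor∤otherPrimes i n =
  prime∤product-without (primeDivisor-prime i n) (primeDivisors-prime n)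

module _ {i n : ℕ} (i<len : i < length (primeDivisors n)) where

  primeDivisor-∈ : primeDivisor i n ∈ primeDivisors n
  primeDivisor-∈ = ∈-lookupOr i<len

  quotient*primeDivisor≡n : quotient i n * primeDivisor i n ≡ n
  quotient*primeDivisor≡n =
    m/n*n≡m {{primeDivisor-nonZero i n}} (proj₂ (∈-primeDivisors⁻ n primeDivisor-∈))

  +quotient*+primeDivisor≡+n : + quotient i n ℤ.* + primeDivisor i n ≡ + n
  +quotient*+primeDivisor≡+n =
    trans (sym (ℤ.pos-* (quotient i n) (primeDivisor i n))) (cong +_ quotient*primeDivisor≡n)

  length≤1+i+primeDivisor : length (primeDivisors n) ≤ suc i + primeDivisor i n
  length≤1+i+primeDivisor = descending⇒length≤1+i+lookupOr (primeDivisors-descending n) i<len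

  primeDivisor∣otherPrimes : ∀ {k} → k < length (primeDivisors n) → k ≢ i →
                             primeDivisor i n ∣ otherPrimes k n
  primeDivisor∣otherPrimes k<len k≢i = ∈⇒∣product-without primeDivisor-∈ (λ qᵢ≡qₖ →
    k≢i (sym (lookupOr-injective primeDivisors-unique i<len k<len qᵢ≡qₖ)))
    where primeDivisors-unique = descending⇒unique (primeDivisors-descending n)

pathRealiser : (ℕ → ℕ) → ℕ → ℕ → ℤ
pathRealiser ξ s n = sumBelow s (λ k → + ξ k ℤ.* + otherPrimes k n)

pathRealiser-congruent : ∀ ξ {s i n} → i < s → s ≤ length (primeDivisors n) →
  + quotient i n ℤ.* pathRealiser ξ s n ≡ + quotient i n ℤ.* (+ ξ i ℤ.* + otherPrimes i n) mod + n
pathRealiser-congruent ξ {s} {i} {n} i<s s≤len =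
  *-monoʳ-mod (+ quotient i n) (+quotient*+primeDivisor≡+n i<len) (sumBelow≡term-mod s i<s term≡0)
  where
  i<len = <-≤-trans i<s s≤len
  term≡0 : ∀ k → k < s → k ≢ i → + ξ k ℤ.* + otherPrimes k n ≡ + 0 mod + primeDivisor i n
  term≡0 k k<s k≢i =
    mod-respʳ (ℤ.*-zeroʳ (+ ξ k))
      (*-cong-mod (mod-refl {x = + ξ k})
        (∣ᵤ⇒≡0-mod (primeDivisor∣otherPrimes i<len (<-≤-trans k<s s≤len) k≢i)))

row-incongruent : ∀ {i n j j'} .{{_ : NonZero n}} →
  suc i + (j ⊔ j') < length (primeDivisors n) → j ≢ j' →
  ¬ (+ quotient i n ℤ.* (+ j ℤ.* + otherPrimes i n) ≡
     + quotient i n ℤ.* (+ j' ℤ.* + otherPrimes i n) mod + n)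
row-incongruent {i} {n} {j} {j'} bound j≢j' congruent =
  prime∤∣m-n∣*o (primeDivisor-prime i n) (primeDivisor∤otherPrimes i n) j≢j' j⊔j'<q
    (mod⇒∣∣m-n∣*o {m = j} {j'} {otherPrimes i n} (*-cancelˡ-mod (+ quotient i n) {{quotient≢0}}
                      (+quotient*+primeDivisor≡+n i<len) congruent))
  where
  i<len : i < length (primeDivisors n)
  i<len = ≤-trans (m≤m+n (suc i) (j ⊔ j')) (<⇒≤ bound)
  j⊔j'<q : j ⊔ j' < primeDivisor i n
  j⊔j'<q = +-cancelˡ-< (suc i) (j ⊔ j') (primeDivisor i n)
             (<-≤-trans bound (length≤1+i+primeDivisor i<len))
  quotient≢0 : NonZero (quotient i n)
  quotient≢0 = m*n≢0⇒m≢0 (quotient i n) {{subst NonZero (sym (quotient*primeDivisor≡n i<len)) it}}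

module _ (U : Ultrafilter) where
  open Ultrafilter U

  Large-zip : ∀ {A B C : Pred ℕ 0ℓ} → (∀ {n} → A n → B n → C n) → Large A → Large B → Large C
  Large-zip f LA LB = upward (λ { (a , b) → f a b }) (intersect LA LB)

  Large⇒¬empty : ∀ {A : Pred ℕ 0ℓ} → Large A → ¬ (∀ n → ¬ A n)
  Large⇒¬empty LA empty = proper (upward (λ {n} → empty n) LA)

  private
    _≈_ : (ℕ → ℤ) → (ℕ → ℤ) → Set
    _≈_ = RawStructure._≈_ (Ultraproduct U)

    ≈⇒mod : ∀ {f g} → f ≈ g → Large (λ n → f n ≡ g n mod + n)
    ≈⇒mod {f} {g} = upward (λ {n} → ∣ᵤ⇒mod {f n} {g n} {+ n})

    mod⇒≈ : ∀ {f g} → Large (λ n → f n ≡ g n mod + n) → f ≈ g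
    mod⇒≈ = upward mod⇒∣ᵤ

  ultraproduct : Structure
  ultraproduct = record
    { raw = Ultraproduct U
    ; isEquivalence = record
      { refl  = λ {f} → mod⇒≈ {f} {f} (upward (λ _ → mod-refl) full)
      ; sym   = λ {f} {g} f≈g → mod⇒≈ (upward mod-sym (≈⇒mod {f} {g} f≈g))
      ; trans = λ {f} {g} {h} f≈g g≈h →
                  mod⇒≈ (Large-zip mod-trans (≈⇒mod {f} {g} f≈g) (≈⇒mod {g} {h} g≈h))
      }
    ; +-cong   = λ {a} {b} {c} {d} a≈b c≈d →
                   mod⇒≈ (Large-zip +-cong-mod (≈⇒mod {a} {b} a≈b) (≈⇒mod {c} {d} c≈d))
    ; *-cong   = λ {a} {b} {c} {d} a≈b c≈d →
                   mod⇒≈ (Large-zip *-cong-mod (≈⇒mod {a} {b} a≈b) (≈⇒mod {c} {d} c≈d))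
    ; neg-cong = λ {a} {b} a≈b → mod⇒≈ (upward neg-cong-mod (≈⇒mod {a} {b} a≈b))
    }

φ : Formula (1 + 2)
φ = (var (fs fz) `* var fz) `≈ (var (fs fz) `* var (fs (fs fz)))

parameter : ℕ → ℕ → Vector (ℕ → ℤ) 2
parameter i j = (λ n → + quotient i n) Vec.∷ (λ n → + j ℤ.* + otherPrimes i n) Vec.∷ Vec.[]

module _ (U : Ultrafilter)
  (manyPrimes : ∀ b → Ultrafilter.Large U (λ n → (0 < n) × AtLeastDistinctPrimeDivisors b n)) where
  open Ultrafilter U

  manyPrimeDivisors : ∀ b → Large (λ n → 0 < n × b ≤ length (primeDivisors n))
  manyPrimeDivisors b =
    upward (λ { (0<n , atLeast) → 0<n , atLeast⇒≤length {{ℕ.>-nonZero 0<n}} atLeast })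
           (manyPrimes b)

  rows-inconsistent : ∀ i (js : Fin 2 → ℕ) → Injective _≡_ _≡_ js →
                      ¬ Realised (ultraproduct U) {1} {2} φ (λ t → parameter i (js t))
  rows-inconsistent i js js-injective (x , x-realises) =
    Large⇒¬empty U (Large-zip U _,_ (Large-zip U _,_ (congruent fz) (congruent (fs fz)))
                                    (manyPrimeDivisors (suc (suc i + (j ⊔ j')))))
      (λ n ((x≡jE , x≡j'E) , 0<n , bound) →
        row-incongruent {{ℕ.>-nonZero 0<n}} bound j≢j' (mod-trans (mod-sym x≡jE) x≡j'E))
    where
    j = js fz
    j' = js (fs fz)
    j≢j' : j ≢ j'
    j≢j' j≡j' with js-injective j≡j'
    ... | ()
    congruent : ∀ t → Large (λ n → + quotient i n ℤ.* x fz n ≡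
                                   + quotient i n ℤ.* (+ js t ℤ.* + otherPrimes i n) mod + n)
    congruent t = upward ∣ᵤ⇒mod (x-realises t)

  paths-consistent : ∀ (ξ : ℕ → ℕ) s →
                     Realised (ultraproduct U) {1} {2} φ {I = Σ ℕ (_< s)}
                       (λ { (i , _) → parameter i (ξ i) })
  paths-consistent ξ s = (λ n → pathRealiser ξ s n) Vec.∷ Vec.[] , λ { (i , i<s) →
    upward (λ { (_ , s≤len) → mod⇒∣ᵤ (pathRealiser-congruent ξ i<s s≤len) }) (manyPrimeDivisors s) }

theorem1p4 : (U : Ultrafilter) →
    (∀ b → Ultrafilter.Large U (λ n → (0 < n) × AtLeastDistinctPrimeDivisors b n)) →
    HasTP2 (Th (Ultraproduct U))
theorem1p4 U manyPrimes =
  1 , 2 , φ , ultraproduct U , (λ _ σ-holds → σ-holds) , parameter , 2 ,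
  rows-inconsistent U manyPrimes , paths-consistent U manyPrimes
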